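{- Let $U,T,S\subseteq\mathbb{Z}_{>0}$ be finite with $U\preceq T\preceq S$. Assume there exists $x\notin T$ with $|U_{<x}|=|T_{<x}|$, and that there exists $y\in T_{<x}$ with $(T\cup\{x\})\setminus\{y\}\preceq S$; let $y$ be the smallest such element. Then for every $S'\subseteq S$, $$U\triangleleft(T\triangleleft S')=U\triangleleft\big(((T\cup\{x\})\setminus\{y\})\triangleleft S'\big),$$ and moreover $U\triangleleft T=U\triangleleft((T\cup\{x\})\setminus\{y\})$.
   Context: For finite $T,S\subseteq\mathbb{Z}_{>0}$, $T\triangleleft S$ is computed by going through $s\in S$ from largest to smallest; each $s$ picks the largest not-yet-picked $t\in T$ with $t<s$, if one exists; $T\triangleleft S$ is the set of picked elements. $S(i)$ denotes the $i$-th smallest element of $S$; $T_{<x}=\{t\in T:t<x\}$. $T\preceq S$ means $|T|\ge|S|$ and $T(i)<S(i)$ for all $i\in[|S|]$. -}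

module Defs where

open import Data.Nat using (ℕ; zero; suc; _<_; _≤_; _⊔_; _<?_; _≟_)
open import Data.List using (List; []; _∷_; length; filter; lookup; reverse)
open import Data.List.Relation.Unary.Linked using (Linked)
open import Data.List.Relation.Unary.All using (All)
open import Data.List.Membership.DecPropositional _≟_ using (_∈?_)
open import Data.Fin using (Fin; inject≤)
open import Data.Maybe using (Maybe; just; nothing)
open import Data.Product using (Σ; _×_)
open import Relation.Nullary using (yes; no; ¬?)

-- A finite subset of ℤ_{>0} is represented canonically by the strictly
-- increasing list of its elements, all of which are positive.
IsPosSet : List ℕ → Set
IsPosSet L = Linked _<_ L × All (λ n → 0 < n) L

below : ℕ → List ℕ → List ℕ
below x T = filter (λ t → t <? x) T

insertS : ℕ → List ℕ → List ℕ
insertS x [] = x ∷ []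
insertS x (t ∷ ts) with x <? t
... | yes _ = x ∷ t ∷ ts
... | no _ with x ≟ t
...   | yes _ = t ∷ ts
...   | no _ = t ∷ insertS x ts

removeS : ℕ → List ℕ → List ℕ
removeS y T = filter (λ t → ¬? (t ≟ y)) T

largestBelow : ℕ → List ℕ → Maybe ℕ
largestBelow s [] = nothing
largestBelow s (t ∷ R) with t <? s
... | no _ = largestBelow s R
... | yes _ with largestBelow s R
...   | nothing = just t
...   | just u = just (t ⊔ u)

-- R: not-yet-picked elements of T; second argument: elements of S in the
-- order they are processed (largest to smallest). Returns the picked elements.
picks : List ℕ → List ℕ → List ℕ
picks R [] = []
picks R (s ∷ ss) with largestBelow s R
... | nothing = picks R ss
... | just t = t ∷ picks (removeS t R) ss

_◁_ : List ℕ → List ℕ → List ℕ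
T ◁ S = filter (λ t → t ∈? picks T (reverse S)) T

-- T ⪯ S : |T| ≥ |S| and T(i) < S(i) for all i ∈ [|S|]
-- (for increasing lists, lookup at position i is the (i+1)-th smallest element)
_⪯_ : List ℕ → List ℕ → Set
T ⪯ S = Σ (length S ≤ length T) λ le →
          (i : Fin (length S)) → lookup T (inject≤ i le) < lookup S i

{-# OPTIONS --safe #-}

-- Let count X p q be the number of elements of X in [p, q). Processing D from the largest
-- element down, the greedy rule picks t from R exactly when some window (t, w] contains more
-- elements of D than (t, w) contains of R (Matched R D t). Hence U ◁ A only depends on which
-- u ∈ U are matched against A, and it does not change when A is replaced by A′ with
-- A ∪ {x} = A′ ∪ {z} (as multisets) for some z ≤ x, provided T ∩ (z, x) ⊆ A and no window
-- [v, x) contains more of U than (v, x) contains of T; the latter follows from U ⪯ T and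
-- |U_{<x}| = |T_{<x}|. For A = T and A′ = T′ = T ∪ {x} ∖ {y} this is the second claim. For the
-- first, minimality of y forces |T_{<y}| ≤ |S_{≤y}|, so no window starting at y holds more of S
-- than of T′; it follows that T′ ◁ S′ arises from T ◁ S′ either unchanged (z = x) or by
-- exchanging x for the last element z of T ∩ [y, x) that T′ ◁ S′ misses.
module Submission where

open import Defs
open import Data.Nat using (ℕ; zero; suc; _+_; _∸_; _<_; _≤_; _>_; z≤n; s≤s; s≤s⁻¹; z<s; _<?_; _≤?_; _≟_; _⊔_)
open import Data.Nat.Properties
open import Relation.Binary.Definitions using (tri<; tri≈; tri>)
open import Algebra.Properties.CommutativeSemigroup +-commutativeSemigroup using (interchange)
open import Data.List using (List; []; _∷_; [_]; length; reverse; lookup)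
open import Data.List.Properties using (filter-accept; filter-reject; filter-≐; unfold-reverse)
open import Data.List.Relation.Unary.Any using (here; there)
import Data.List.Relation.Unary.Any.Properties as Any
open import Data.List.Relation.Unary.All as All using (All; []; _∷_)
open import Data.List.Relation.Unary.AllPairs using (AllPairs; []; _∷_)
import Data.List.Relation.Unary.AllPairs.Properties as AllPairs
open import Data.List.Relation.Unary.Linked.Properties using (Linked⇒AllPairs)
open import Data.List.Membership.Propositional using (_∈_; _∉_)
open import Data.List.Membership.Propositional.Properties using (∈-filter⁺; ∈-filter⁻)
open import Data.List.Membership.DecPropositional _≟_ using (_∈?_)
open import Data.Fin using (Fin; inject≤) renaming (zero to fzero; suc to fsuc)
open import Data.Bool using (if_then_else_)
open import Data.Maybe using (Maybe; just; nothing)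
open import Data.Product using (∃-syntax; _×_; _,_; proj₁; proj₂; map₂)
open import Data.Sum using (_⊎_; inj₁; inj₂)
open import Data.Empty using (⊥-elim)
open import Function using (_∘_; case_of_; _⇔_; mk⇔; Equivalence)
open import Relation.Nullary using (Dec; does; yes; no; ¬_; ¬?; _×-dec_)
open import Induction.WellFounded using (Acc; acc)
open import Data.Nat.Induction using (<-wellFounded)
open import Relation.Binary.PropositionalEquality
  using (_≡_; _≢_; refl; sym; trans; cong; cong₂; subst; module ≡-Reasoning)

sumFrom : (ℕ → ℕ) → ℕ → ℕ → ℕ
sumFrom f a zero    = 0
sumFrom f a (suc k) = f a + sumFrom f (suc a) k

intervalSum : (ℕ → ℕ) → ℕ → ℕ → ℕ
intervalSum f p q = sumFrom f p (q ∸ p)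

sumFrom-split : ∀ f a k m → sumFrom f a (k + m) ≡ sumFrom f a k + sumFrom f (a + k) m
sumFrom-split f a zero    m rewrite +-identityʳ a = refl
sumFrom-split f a (suc k) m rewrite sumFrom-split f (suc a) k m | +-suc a k =
  sym (+-assoc (f a) (sumFrom f (suc a) k) (sumFrom f (suc (a + k)) m))

sumFrom-mono : ∀ f g a k → (∀ v → a ≤ v → v < a + k → f v ≤ g v) → sumFrom f a k ≤ sumFrom g a k
sumFrom-mono f g a zero    f≤g = z≤n
sumFrom-mono f g a (suc k) f≤g = +-mono-≤ (f≤g a ≤-refl a<a+1+k) (sumFrom-mono f g (suc a) k f≤g′)
  where
  a<a+1+k : a < a + suc k
  a<a+1+k = subst (a <_) (sym (+-suc a k)) (s≤s (m≤m+n a k))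
  f≤g′ : ∀ v → suc a ≤ v → v < suc a + k → f v ≤ g v
  f≤g′ v a<v v<1+a+k = f≤g v (<⇒≤ a<v) (subst (v <_) (sym (+-suc a k)) v<1+a+k)

sumFrom-+ : ∀ f g a k → sumFrom (λ v → f v + g v) a k ≡ sumFrom f a k + sumFrom g a k
sumFrom-+ f g a zero    = refl
sumFrom-+ f g a (suc k) rewrite sumFrom-+ f g (suc a) k =
  interchange (f a) (g a) (sumFrom f (suc a) k) (sumFrom g (suc a) k)

sumFrom-zero : ∀ a k → sumFrom (λ _ → 0) a k ≡ 0
sumFrom-zero a zero    = refl
sumFrom-zero a (suc k) = sumFrom-zero (suc a) k

intervalSum-split : ∀ f {p q r} → p ≤ q → q ≤ r → intervalSum f p r ≡ intervalSum f p q + intervalSum f q r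
intervalSum-split f {p} {q} {r} p≤q q≤r = begin
  sumFrom f p (r ∸ p)                              ≡⟨ cong (sumFrom f p) r∸p≡ ⟩
  sumFrom f p ((q ∸ p) + (r ∸ q))                  ≡⟨ sumFrom-split f p (q ∸ p) (r ∸ q) ⟩
  sumFrom f p (q ∸ p) + sumFrom f (p + (q ∸ p)) (r ∸ q)
    ≡⟨ cong (λ a → sumFrom f p (q ∸ p) + sumFrom f a (r ∸ q)) (m+[n∸m]≡n p≤q) ⟩
  sumFrom f p (q ∸ p) + sumFrom f q (r ∸ q)        ∎
  where
  open ≡-Reasoning
  r∸p≡ : r ∸ p ≡ (q ∸ p) + (r ∸ q)
  r∸p≡ = trans (cong (_∸ p) (sym (m+[n∸m]≡n q≤r))) (+-∸-comm (r ∸ q) p≤q)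

intervalSum-empty : ∀ f {p q} → q ≤ p → intervalSum f p q ≡ 0
intervalSum-empty f q≤p rewrite m≤n⇒m∸n≡0 q≤p = refl

intervalSum-singleton : ∀ f p → intervalSum f p (suc p) ≡ f p
intervalSum-singleton f p rewrite m+n∸n≡m 1 p = +-identityʳ (f p)

intervalSum-mono : ∀ f g p q → (∀ v → p ≤ v → v < q → f v ≤ g v) → intervalSum f p q ≤ intervalSum g p q
intervalSum-mono f g p q f≤g with p ≤? q
... | yes p≤q = sumFrom-mono f g p (q ∸ p) (λ v p≤v v<q → f≤g v p≤v (subst (v <_) (m+[n∸m]≡n p≤q) v<q))
... | no p≰q  = ≤-trans (≤-reflexive (intervalSum-empty f (<⇒≤ (≰⇒> p≰q)))) z≤n

intervalSum-cong : ∀ f g p q → (∀ v → p ≤ v → v < q → f v ≡ g v) → intervalSum f p q ≡ intervalSum g p q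
intervalSum-cong f g p q f≡g = ≤-antisym
  (intervalSum-mono f g p q (λ v p≤v v<q → ≤-reflexive (f≡g v p≤v v<q)))
  (intervalSum-mono g f p q (λ v p≤v v<q → ≤-reflexive (sym (f≡g v p≤v v<q))))

intervalSum-+ : ∀ f g p q → intervalSum (λ v → f v + g v) p q ≡ intervalSum f p q + intervalSum g p q
intervalSum-+ f g p q = sumFrom-+ f g p (q ∸ p)

intervalSum-zero : ∀ f p q → (∀ v → p ≤ v → v < q → f v ≡ 0) → intervalSum f p q ≡ 0
intervalSum-zero f p q f≡0 = trans (intervalSum-cong f (λ _ → 0) p q f≡0) (sumFrom-zero p (q ∸ p))

intervalSum-monoʳ : ∀ f p {q r} → q ≤ r → intervalSum f p q ≤ intervalSum f p r
intervalSum-monoʳ f p {q} {r} q≤r with p ≤? q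
... | yes p≤q = ≤-trans (m≤m+n _ _) (≤-reflexive (sym (intervalSum-split f p≤q q≤r)))
... | no p≰q  = ≤-trans (≤-reflexive (intervalSum-empty f (<⇒≤ (≰⇒> p≰q)))) z≤n

opaque
  χ : List ℕ → ℕ → ℕ
  χ X v = if does (v ∈? X) then 1 else 0

  χ-∈ : ∀ {X v} → v ∈ X → χ X v ≡ 1
  χ-∈ {X} {v} v∈X with v ∈? X
  ... | yes _   = refl
  ... | no v∉X = ⊥-elim (v∉X v∈X)

  χ-∉ : ∀ {X v} → v ∉ X → χ X v ≡ 0
  χ-∉ {X} {v} v∉X with v ∈? X
  ... | yes v∈X = ⊥-elim (v∉X v∈X)
  ... | no _    = refl

  χ-mono : ∀ {X Y v} → (v ∈ X → v ∈ Y) → χ X v ≤ χ Y v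
  χ-mono {X} {Y} {v} X⊆Y with v ∈? X | v ∈? Y
  ... | yes _   | yes _   = ≤-refl
  ... | no _    | _       = z≤n
  ... | yes v∈X | no v∉Y = ⊥-elim (v∉Y (X⊆Y v∈X))

χ-cong : ∀ {X Y v} → (v ∈ X → v ∈ Y) → (v ∈ Y → v ∈ X) → χ X v ≡ χ Y v
χ-cong X⊆Y Y⊆X = ≤-antisym (χ-mono X⊆Y) (χ-mono Y⊆X)

χ-singleton-≢ : ∀ {a v} → v ≢ a → χ [ a ] v ≡ 0
χ-singleton-≢ {a} v≢a = χ-∉ {[ a ]} λ { (here v≡a) → v≢a v≡a }

-- Opaque, so that X, p and q can be inferred from count X p q during unification.
opaque
  count : List ℕ → ℕ → ℕ → ℕ
  count X = intervalSum (χ X)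

  count-split : ∀ X {p q r} → p ≤ q → q ≤ r → count X p r ≡ count X p q + count X q r
  count-split X = intervalSum-split (χ X)

  count-point : ∀ X a → count X a (suc a) ≡ χ X a
  count-point X = intervalSum-singleton (χ X)

  count-empty : ∀ X {p q} → q ≤ p → count X p q ≡ 0
  count-empty X = intervalSum-empty (χ X)

  count-monoʳ : ∀ X p {q r} → q ≤ r → count X p q ≤ count X p r
  count-monoʳ X = intervalSum-monoʳ (χ X)

  count-mono : ∀ {X Y} p q → (∀ {v} → p ≤ v → v < q → v ∈ X → v ∈ Y) → count X p q ≤ count Y p q
  count-mono p q X⊆Y = intervalSum-mono _ _ p q (λ v p≤v v<q → χ-mono (X⊆Y p≤v v<q))

  count-zero : ∀ {X} p q → (∀ {v} → p ≤ v → v < q → v ∉ X) → count X p q ≡ 0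
  count-zero p q disjoint = intervalSum-zero _ p q (λ v p≤v v<q → χ-∉ (disjoint p≤v v<q))

  count-+ : ∀ {A B C} → (∀ v → χ A v ≡ χ B v + χ C v) → ∀ p q → count A p q ≡ count B p q + count C p q
  count-+ {A} {B} {C} χ-+ p q =
    trans (intervalSum-cong (χ A) _ p q (λ v _ _ → χ-+ v)) (intervalSum-+ (χ B) (χ C) p q)

  count-pointwise : ∀ {A B C D} → (∀ v → χ A v + χ B v ≡ χ C v + χ D v) →
    ∀ p q → count A p q + count B p q ≡ count C p q + count D p q
  count-pointwise {A} {B} {C} {D} χ-eq p q = begin
    intervalSum (χ A) p q + intervalSum (χ B) p q     ≡⟨ intervalSum-+ (χ A) (χ B) p q ⟨
    intervalSum (λ v → χ A v + χ B v) p q             ≡⟨ intervalSum-cong _ _ p q (λ v _ _ → χ-eq v) ⟩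
    intervalSum (λ v → χ C v + χ D v) p q             ≡⟨ intervalSum-+ (χ C) (χ D) p q ⟩
    intervalSum (χ C) p q + intervalSum (χ D) p q     ∎
    where open ≡-Reasoning

count-split-at : ∀ X {p a q} → p ≤ a → a < q → count X p q ≡ count X p a + (χ X a + count X (suc a) q)
count-split-at X {p} {a} {q} p≤a a<q = begin
  count X p q                                   ≡⟨ count-split X p≤a (<⇒≤ a<q) ⟩
  count X p a + count X a q                     ≡⟨ cong (count X p a +_) (count-split X (n≤1+n a) a<q) ⟩
  count X p a + (count X a (suc a) + count X (suc a) q)
    ≡⟨ cong (λ c → count X p a + (c + count X (suc a) q)) (count-point X a) ⟩
  count X p a + (χ X a + count X (suc a) q)     ∎
  where open ≡-Reasoning

count-split-at-∈ : ∀ {X p a q} → a ∈ X → p ≤ a → a < q → count X p q ≡ count X p a + suc (count X (suc a) q)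
count-split-at-∈ {X} {p} {a} {q} a∈X p≤a a<q =
  trans (count-split-at X p≤a a<q) (cong (λ c → count X p a + (c + count X (suc a) q)) (χ-∈ a∈X))

count-split-at-∉ : ∀ {X p a q} → a ∉ X → p ≤ a → a < q → count X p q ≡ count X p a + count X (suc a) q
count-split-at-∉ {X} {p} {a} {q} a∉X p≤a a<q =
  trans (count-split-at X p≤a a<q) (cong (λ c → count X p a + (c + count X (suc a) q)) (χ-∉ a∉X))

count-∈-head : ∀ {X a q} → a ∈ X → a < q → count X a q ≡ suc (count X (suc a) q)
count-∈-head {X} {a} {q} a∈X a<q = begin
  count X a q                              ≡⟨ count-split X (n≤1+n a) a<q ⟩
  count X a (suc a) + count X (suc a) q    ≡⟨ cong (_+ count X (suc a) q) (trans (count-point X a) (χ-∈ a∈X)) ⟩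
  suc (count X (suc a) q)                  ∎
  where open ≡-Reasoning

count-∈-last : ∀ {X a p} → a ∈ X → p ≤ a → count X p (suc a) ≡ suc (count X p a)
count-∈-last {X} {a} {p} a∈X p≤a = begin
  count X p (suc a)                        ≡⟨ count-split X p≤a (n≤1+n a) ⟩
  count X p a + count X a (suc a)          ≡⟨ cong (count X p a +_) (trans (count-point X a) (χ-∈ a∈X)) ⟩
  count X p a + 1                          ≡⟨ +-comm _ 1 ⟩
  suc (count X p a)                        ∎
  where open ≡-Reasoning

count-∉-last : ∀ {X a p} → a ∉ X → p ≤ a → count X p (suc a) ≡ count X p a
count-∉-last {X} {a} {p} a∉X p≤a = begin
  count X p (suc a)                        ≡⟨ count-split X p≤a (n≤1+n a) ⟩
  count X p a + count X a (suc a)          ≡⟨ cong (count X p a +_) (trans (count-point X a) (χ-∉ a∉X)) ⟩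
  count X p a + 0                          ≡⟨ +-identityʳ _ ⟩
  count X p a                              ∎
  where open ≡-Reasoning

count-⊆ : ∀ {X Y} p q → (∀ {v} → v ∈ X → v ∈ Y) → count X p q ≤ count Y p q
count-⊆ p q X⊆Y = count-mono p q (λ _ _ → X⊆Y)

count-singleton-outside : ∀ {a p q} → a < p ⊎ q ≤ a → count [ a ] p q ≡ 0
count-singleton-outside {a} {p} {q} (inj₁ a<p) = count-zero p q λ p≤v _ → λ { (here refl) → <⇒≱ a<p p≤v }
count-singleton-outside {a} {p} {q} (inj₂ q≤a) = count-zero p q λ _ v<q → λ { (here refl) → <⇒≱ v<q q≤a }

count-singleton-inside : ∀ {a p q} → p ≤ a → a < q → count [ a ] p q ≡ 1
count-singleton-inside {a} {p} {q} p≤a a<q = begin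
  count [ a ] p q                                          ≡⟨ count-split-at [ a ] p≤a a<q ⟩
  count [ a ] p a + (χ [ a ] a + count [ a ] (suc a) q)
    ≡⟨ cong₂ (λ l r → l + (χ [ a ] a + r)) (count-singleton-outside (inj₂ ≤-refl))
                                          (count-singleton-outside (inj₁ ≤-refl)) ⟩
  χ [ a ] a + 0                                            ≡⟨ cong (_+ 0) (χ-∈ {[ a ]} (here refl)) ⟩
  1                                                        ∎
  where open ≡-Reasoning

count-singleton≤1 : ∀ a p q → count [ a ] p q ≤ 1
count-singleton≤1 a p q with p ≤? a | a <? q
... | yes p≤a | yes a<q = ≤-reflexive (count-singleton-inside p≤a a<q)
... | no p≰a  | _       = ≤-trans (≤-reflexive (count-singleton-outside (inj₁ (≰⇒> p≰a)))) z≤n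
... | _       | no a≮q  = ≤-trans (≤-reflexive (count-singleton-outside (inj₂ (≮⇒≥ a≮q)))) z≤n

χ-∷ : ∀ {a X} → a ∉ X → ∀ v → χ (a ∷ X) v ≡ χ X v + χ [ a ] v
χ-∷ {a} {X} a∉X v with v ≟ a
... | yes refl rewrite χ-∈ {v ∷ X} (here refl) | χ-∉ a∉X | χ-∈ {[ v ]} (here refl) = refl
... | no v≢a   rewrite χ-singleton-≢ v≢a | +-identityʳ (χ X v) =
  χ-cong (λ { (here v≡a) → ⊥-elim (v≢a v≡a) ; (there v∈X) → v∈X }) there

∈-removeS⁻ : ∀ {v} y T → v ∈ removeS y T → v ∈ T × v ≢ y
∈-removeS⁻ y T = ∈-filter⁻ (λ t → ¬? (t ≟ y))

∈-removeS⁺ : ∀ {v} y T → v ∈ T → v ≢ y → v ∈ removeS y T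
∈-removeS⁺ y T = ∈-filter⁺ (λ t → ¬? (t ≟ y))

y∉removeS : ∀ y T → y ∉ removeS y T
y∉removeS y T y∈ = proj₂ (∈-removeS⁻ y T y∈) refl

∈-insertS⁻ : ∀ {v} x T → v ∈ insertS x T → v ≡ x ⊎ v ∈ T
∈-insertS⁻ x [] (here v≡x) = inj₁ v≡x
∈-insertS⁻ x (t ∷ ts) v∈ with x <? t
∈-insertS⁻ x (t ∷ ts) (here v≡x) | yes _ = inj₁ v≡x
∈-insertS⁻ x (t ∷ ts) (there v∈) | yes _ = inj₂ v∈
... | no _ with x ≟ t
...   | yes _ = inj₂ v∈
∈-insertS⁻ x (t ∷ ts) (here v≡t)  | no _ | no _ = inj₂ (here v≡t)
∈-insertS⁻ x (t ∷ ts) (there v∈) | no _ | no _ with ∈-insertS⁻ x ts v∈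
... | inj₁ v≡x   = inj₁ v≡x
... | inj₂ v∈ts = inj₂ (there v∈ts)

x∈insertS : ∀ x T → x ∈ insertS x T
x∈insertS x [] = here refl
x∈insertS x (t ∷ ts) with x <? t
... | yes _ = here refl
... | no _ with x ≟ t
...   | yes x≡t = here x≡t
...   | no _    = there (x∈insertS x ts)

∈-insertS⁺ : ∀ {v} x T → v ∈ T → v ∈ insertS x T
∈-insertS⁺ x (t ∷ ts) v∈ with x <? t
... | yes _ = there v∈
... | no _ with x ≟ t
...   | yes _ = v∈
...   | no _ with v∈
...     | here v≡t   = here v≡t
...     | there v∈ts = there (∈-insertS⁺ x ts v∈ts)

χ-removeS : ∀ {r R} → r ∈ R → ∀ v → χ R v ≡ χ (removeS r R) v + χ [ r ] v
χ-removeS {r} {R} r∈R v with v ≟ r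
... | yes refl rewrite χ-∈ r∈R | χ-∉ (y∉removeS v R) | χ-∈ {[ v ]} (here refl) = refl
... | no v≢r   rewrite χ-singleton-≢ v≢r | +-identityʳ (χ (removeS r R) v) =
  χ-cong (λ v∈R → ∈-removeS⁺ r R v∈R v≢r) (λ v∈ → proj₁ (∈-removeS⁻ r R v∈))

Exchange : List ℕ → List ℕ → ℕ → ℕ → Set
Exchange A A′ x z = ∀ v → χ A v + χ [ x ] v ≡ χ A′ v + χ [ z ] v

exchange-sym : ∀ {A A′ x z} → Exchange A A′ x z → Exchange A′ A z x
exchange-sym e v = sym (e v)

exchange-swap : ∀ {A A′ x z} → x ∉ A → x ∈ A′ → z ∈ A → z ∉ A′ →
  (∀ {v} → v ≢ z → v ∈ A → v ∈ A′) → (∀ {v} → v ≢ x → v ∈ A′ → v ∈ A) → Exchange A A′ x z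
exchange-swap {A} {A′} {x} {z} x∉A x∈A′ z∈A z∉A′ A⊆A′ A′⊆A v with v ≟ x | v ≟ z
... | yes refl | yes refl = ⊥-elim (x∉A z∈A)
... | yes refl | no v≢z
  rewrite χ-∉ x∉A | χ-∈ {[ v ]} (here refl) | χ-∈ x∈A′ | χ-singleton-≢ v≢z = refl
... | no v≢x   | yes refl
  rewrite χ-∈ z∈A | χ-singleton-≢ v≢x | χ-∉ z∉A′ | χ-∈ {[ v ]} (here refl) = refl
... | no v≢x   | no v≢z
  rewrite χ-singleton-≢ v≢x | χ-singleton-≢ v≢z = cong (_+ 0) (χ-cong (A⊆A′ v≢z) (A′⊆A v≢x))

module _ {x y : ℕ} {T : List ℕ} where

  x∈insertS-removeS : x ≢ y → x ∈ removeS y (insertS x T)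
  x∈insertS-removeS x≢y = ∈-removeS⁺ y (insertS x T) (x∈insertS x T) x≢y

  ∈-insertS-removeS⁺ : ∀ {v} → v ≢ y → v ∈ T → v ∈ removeS y (insertS x T)
  ∈-insertS-removeS⁺ v≢y v∈T = ∈-removeS⁺ y (insertS x T) (∈-insertS⁺ x T v∈T) v≢y

  ∈-insertS-removeS⁻ : ∀ {v} → v ≢ x → v ∈ removeS y (insertS x T) → v ∈ T
  ∈-insertS-removeS⁻ v≢x v∈ with ∈-insertS⁻ x T (proj₁ (∈-removeS⁻ y (insertS x T) v∈))
  ... | inj₁ v≡x = ⊥-elim (v≢x v≡x)
  ... | inj₂ v∈T = v∈T

  exchange-insertS-removeS : x ∉ T → y ∈ T → Exchange T (removeS y (insertS x T)) x y
  exchange-insertS-removeS x∉T y∈T = exchange-swap x∉T (x∈insertS-removeS x≢y) y∈T (y∉removeS y (insertS x T))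
    ∈-insertS-removeS⁺ ∈-insertS-removeS⁻
    where
    x≢y : x ≢ y
    x≢y refl = x∉T y∈T

exchange-same : ∀ {A A′ x} → (∀ {v} → v ∈ A → v ∈ A′) → (∀ {v} → v ∈ A′ → v ∈ A) → Exchange A A′ x x
exchange-same A⊆A′ A′⊆A v = cong (_+ _) (χ-cong A⊆A′ A′⊆A)

exchange-trans : ∀ {A B C x y z} → Exchange A B x y → Exchange A C x z → Exchange B C y z
exchange-trans A⇄B A⇄C v = trans (sym (A⇄B v)) (A⇄C v)

module ExchangeCounts {A A′ : List ℕ} {x z : ℕ} (e : Exchange A A′ x z) where

  count-exchange : ∀ p q → count A p q + count [ x ] p q ≡ count A′ p q + count [ z ] p q
  count-exchange = count-pointwise e

  exchange-≡ : ∀ {p q} → count [ x ] p q ≡ count [ z ] p q → count A p q ≡ count A′ p q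
  exchange-≡ {p} {q} x≡z = +-cancelʳ-≡ (count [ z ] p q) _ _
    (trans (cong (count A p q +_) (sym x≡z)) (count-exchange p q))

  exchange-outside : ∀ {p q} → x < p ⊎ q ≤ x → z < p ⊎ q ≤ z → count A p q ≡ count A′ p q
  exchange-outside x∉ z∉ = exchange-≡ (trans (count-singleton-outside x∉) (sym (count-singleton-outside z∉)))

  exchange-inside : ∀ {p q} → p ≤ x → x < q → p ≤ z → z < q → count A p q ≡ count A′ p q
  exchange-inside p≤x x<q p≤z z<q =
    exchange-≡ (trans (count-singleton-inside p≤x x<q) (sym (count-singleton-inside p≤z z<q)))

  exchange-gain : ∀ {p q} → p ≤ x → x < q → z < p ⊎ q ≤ z → count A′ p q ≡ suc (count A p q)
  exchange-gain {p} {q} p≤x x<q z∉ = begin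
    count A′ p q                          ≡⟨ +-identityʳ _ ⟨
    count A′ p q + 0                      ≡⟨ cong (count A′ p q +_) (count-singleton-outside z∉) ⟨
    count A′ p q + count [ z ] p q        ≡⟨ count-exchange p q ⟨
    count A p q + count [ x ] p q         ≡⟨ cong (count A p q +_) (count-singleton-inside p≤x x<q) ⟩
    count A p q + 1                       ≡⟨ +-comm _ 1 ⟩
    suc (count A p q)                     ∎
    where open ≡-Reasoning

  exchange-≤ : ∀ {p q} → z < p ⊎ q ≤ z → count A p q ≤ count A′ p q
  exchange-≤ {p} {q} z∉ = begin
    count A p q                           ≤⟨ m≤m+n _ _ ⟩
    count A p q + count [ x ] p q         ≡⟨ count-exchange p q ⟩
    count A′ p q + count [ z ] p q        ≡⟨ cong (count A′ p q +_) (count-singleton-outside z∉) ⟩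
    count A′ p q + 0                      ≡⟨ +-identityʳ _ ⟩
    count A′ p q                          ∎
    where open ≤-Reasoning

  exchange-≤suc : ∀ p q → count A′ p q ≤ suc (count A p q)
  exchange-≤suc p q = begin
    count A′ p q                          ≤⟨ m≤m+n _ _ ⟩
    count A′ p q + count [ z ] p q        ≡⟨ count-exchange p q ⟨
    count A p q + count [ x ] p q         ≤⟨ +-monoʳ-≤ (count A p q) (count-singleton≤1 x p q) ⟩
    count A p q + 1                       ≡⟨ +-comm _ 1 ⟩
    suc (count A p q)                     ∎
    where open ≤-Reasoning

count-∷ : ∀ {a X} → a ∉ X → ∀ p q → count (a ∷ X) p q ≡ count X p q + count [ a ] p q
count-∷ a∉X = count-+ (χ-∷ a∉X)

count-removeS : ∀ {r R} → r ∈ R → ∀ p q → count R p q ≡ count (removeS r R) p q + count [ r ] p q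
count-removeS r∈R = count-+ (χ-removeS r∈R)

count-∷-inside : ∀ {a X p q} → a ∉ X → p ≤ a → a < q → count (a ∷ X) p q ≡ suc (count X p q)
count-∷-inside {a} {X} {p} {q} a∉X p≤a a<q = begin
  count (a ∷ X) p q              ≡⟨ count-∷ a∉X p q ⟩
  count X p q + count [ a ] p q  ≡⟨ cong (count X p q +_) (count-singleton-inside p≤a a<q) ⟩
  count X p q + 1                ≡⟨ +-comm _ 1 ⟩
  suc (count X p q)              ∎
  where open ≡-Reasoning

count-∷-outside : ∀ {a X p q} → a ∉ X → a < p ⊎ q ≤ a → count (a ∷ X) p q ≡ count X p q
count-∷-outside {a} {X} {p} {q} a∉X a-out = begin
  count (a ∷ X) p q              ≡⟨ count-∷ a∉X p q ⟩
  count X p q + count [ a ] p q  ≡⟨ cong (count X p q +_) (count-singleton-outside a-out) ⟩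
  count X p q + 0                ≡⟨ +-identityʳ _ ⟩
  count X p q                    ∎
  where open ≡-Reasoning

count-removeS-inside : ∀ {r R p q} → r ∈ R → p ≤ r → r < q → count R p q ≡ suc (count (removeS r R) p q)
count-removeS-inside {r} {R} {p} {q} r∈R p≤r r<q = begin
  count R p q                                    ≡⟨ count-removeS r∈R p q ⟩
  count (removeS r R) p q + count [ r ] p q
    ≡⟨ cong (count (removeS r R) p q +_) (count-singleton-inside p≤r r<q) ⟩
  count (removeS r R) p q + 1                    ≡⟨ +-comm _ 1 ⟩
  suc (count (removeS r R) p q)                  ∎
  where open ≡-Reasoning

count-removeS-outside : ∀ {r R p q} → r ∈ R → r < p ⊎ q ≤ r → count R p q ≡ count (removeS r R) p q
count-removeS-outside {r} {R} {p} {q} r∈R r-out = begin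
  count R p q                                    ≡⟨ count-removeS r∈R p q ⟩
  count (removeS r R) p q + count [ r ] p q
    ≡⟨ cong (count (removeS r R) p q +_) (count-singleton-outside r-out) ⟩
  count (removeS r R) p q + 0                    ≡⟨ +-identityʳ _ ⟩
  count (removeS r R) p q                        ∎
  where open ≡-Reasoning

count-≥ : ∀ {X} p q → (∀ {v} → v ∈ X → q ≤ v) → count X p q ≡ 0
count-≥ p q q≤X = count-zero p q (λ _ v<q v∈X → <⇒≱ v<q (q≤X v∈X))

count-∈ : ∀ {X v} p q → v ∈ X → p ≤ v → v < q → 1 ≤ count X p q
count-∈ {X} {v} p q v∈X p≤v v<q =
  ≤-trans (s≤s z≤n) (≤-trans (m≤n+m _ (count X p v)) (≤-reflexive (sym (count-split-at-∈ v∈X p≤v v<q))))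

Increasing : List ℕ → Set
Increasing = AllPairs _<_

IsPosSet⇒Increasing : ∀ {X} → IsPosSet X → Increasing X
IsPosSet⇒Increasing (linked , _) = Linked⇒AllPairs <-trans linked

∉-below : ∀ {a X} → All (a <_) X → a ∉ X
∉-below a<X a∈X = <-irrefl refl (All.lookup a<X a∈X)

∉-above : ∀ {a X} → All (_< a) X → a ∉ X
∉-above X<a a∈X = <-irrefl refl (All.lookup X<a a∈X)

All-insertS : ∀ {P : ℕ → Set} x T → P x → All P T → All P (insertS x T)
All-insertS x []       Px []         = Px ∷ []
All-insertS x (t ∷ ts) Px (Pt ∷ Pts) with x <? t
... | yes _ = Px ∷ Pt ∷ Pts
... | no _ with x ≟ t
...   | yes _ = Pt ∷ Pts
...   | no _  = Pt ∷ All-insertS x ts Px Pts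

Increasing-insertS : ∀ x {T} → Increasing T → Increasing (insertS x T)
Increasing-insertS x {[]}     []             = [] ∷ []
Increasing-insertS x {t ∷ ts} (t<ts ∷ inc) with x <? t
... | yes x<t = (x<t ∷ All.map (<-trans x<t) t<ts) ∷ t<ts ∷ inc
... | no x≮t with x ≟ t
...   | yes _   = t<ts ∷ inc
...   | no x≢t = All-insertS x ts (≤∧≢⇒< (≮⇒≥ x≮t) (x≢t ∘ sym)) t<ts ∷ Increasing-insertS x inc

Increasing-removeS : ∀ y {T} → Increasing T → Increasing (removeS y T)
Increasing-removeS y = AllPairs.filter⁺ (λ t → ¬? (t ≟ y))

Increasing-◁ : ∀ {T} S → Increasing T → Increasing (T ◁ S)
Increasing-◁ S = AllPairs.filter⁺ (λ t → t ∈? picks _ (reverse S))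

Decreasing-reverse : ∀ {X} → Increasing X → AllPairs _>_ (reverse X)
Decreasing-reverse {[]}    []           = []
Decreasing-reverse {x ∷ X} (x<X ∷ inc) rewrite unfold-reverse x X =
  AllPairs.++⁺ (Decreasing-reverse inc) ([] ∷ [])
    (All.tabulate (λ v∈ → All.lookup x<X (Any.reverse⁻ v∈) ∷ []))

length-below : ∀ x {X} → Increasing X → length (below x X) ≡ count X 0 x
length-below x {[]}    []           = sym (count-zero 0 x (λ _ _ ()))
length-below x {a ∷ X} (a<X ∷ inc) with a <? x
... | yes a<x rewrite filter-accept (_<? x) {a} {X} a<x | count-∷ (∉-below a<X) 0 x
                    | count-singleton-inside z≤n a<x | length-below x inc = +-comm 1 (count X 0 x)
... | no a≮x  rewrite filter-reject (_<? x) {a} {X} a≮x | count-∷ (∉-below a<X) 0 x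
                    | count-singleton-outside {a} {0} {x} (inj₂ (≮⇒≥ a≮x)) | length-below x inc =
  sym (+-identityʳ (count X 0 x))

_⪯ᶜ_ : List ℕ → List ℕ → Set
A ⪯ᶜ B = ∀ v → count B 0 (suc v) ≤ count A 0 v

⪯-∷⁻ : ∀ {a b A B} → (a ∷ A) ⪯ (b ∷ B) → a < b × A ⪯ B
⪯-∷⁻ (le , lt) = lt fzero , (s≤s⁻¹ le , λ i → lt (fsuc i))

⪯-∷⁺ : ∀ {a b A B} → a < b → A ⪯ B → (a ∷ A) ⪯ (b ∷ B)
⪯-∷⁺ {a} {b} {A} {B} a<b (le , lt) = s≤s le , lt′
  where
  lt′ : (i : Fin (suc (length B))) → lookup (a ∷ A) (inject≤ i (s≤s le)) < lookup (b ∷ B) i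
  lt′ fzero    = a<b
  lt′ (fsuc i) = lt i

count-∷-≤head : ∀ {a X p q} → All (a <_) X → q ≤ a → count (a ∷ X) p q ≡ 0
count-∷-≤head {p = p} {q} a<X q≤a = count-≥ p q λ
  { (here refl)  → q≤a
  ; (there v∈X) → ≤-trans q≤a (<⇒≤ (All.lookup a<X v∈X)) }

⪯⇒⪯ᶜ : ∀ {A B} → Increasing A → Increasing B → A ⪯ B → A ⪯ᶜ B
⪯⇒⪯ᶜ {A} {[]}    _ _ _ v = ≤-trans (≤-reflexive (count-zero 0 (suc v) (λ _ _ ()))) z≤n
⪯⇒⪯ᶜ {[]} {_ ∷ _} _ _ (() , _)
⪯⇒⪯ᶜ {a ∷ A} {b ∷ B} (a<A ∷ incA) (b<B ∷ incB) ab⪯ v with ⪯-∷⁻ ab⪯ | v <? b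
... | _ | yes v<b = ≤-trans (≤-reflexive (count-∷-≤head b<B v<b)) z≤n
... | a<b , A⪯B | no v≮b = begin
  count (b ∷ B) 0 (suc v)   ≡⟨ count-∷-inside (∉-below b<B) z≤n (s≤s (≮⇒≥ v≮b)) ⟩
  suc (count B 0 (suc v))   ≤⟨ s≤s (⪯⇒⪯ᶜ incA incB A⪯B v) ⟩
  suc (count A 0 v)         ≡⟨ count-∷-inside (∉-below a<A) z≤n (<-≤-trans a<b (≮⇒≥ v≮b)) ⟨
  count (a ∷ A) 0 v         ∎
  where open ≤-Reasoning

⪯ᶜ⇒⪯ : ∀ {A B} → Increasing A → Increasing B → A ⪯ᶜ B → A ⪯ B
⪯ᶜ⇒⪯ {A} {[]} _ _ _ = z≤n , λ ()
⪯ᶜ⇒⪯ {[]} {b ∷ B} _ _ []⪯ᶜ = ⊥-elim (<⇒≱ (count-∈ 0 (suc b) (here refl) z≤n ≤-refl)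
                                            (≤-trans ([]⪯ᶜ b) (≤-reflexive (count-zero 0 b (λ _ _ ())))))
⪯ᶜ⇒⪯ {a ∷ A} {b ∷ B} (a<A ∷ incA) (b<B ∷ incB) ab⪯ᶜ = ⪯-∷⁺ a<b (⪯ᶜ⇒⪯ incA incB A⪯ᶜB)
  where
  a<b : a < b
  a<b with a <? b
  ... | yes a<b = a<b
  ... | no a≮b  = ⊥-elim (<⇒≱ (count-∈ 0 (suc b) (here refl) z≤n ≤-refl)
                              (≤-trans (ab⪯ᶜ b) (≤-reflexive (count-∷-≤head a<A (≮⇒≥ a≮b)))))
  A⪯ᶜB : A ⪯ᶜ B
  A⪯ᶜB v with v <? b
  ... | yes v<b = ≤-trans (≤-reflexive (count-≥ 0 (suc v) (λ v∈B → <-trans v<b (All.lookup b<B v∈B)))) z≤n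
  ... | no v≮b  = s≤s⁻¹ (begin
    suc (count B 0 (suc v))          ≡⟨ count-∷-inside (∉-below b<B) z≤n (s≤s (≮⇒≥ v≮b)) ⟨
    count (b ∷ B) 0 (suc v)          ≤⟨ ab⪯ᶜ v ⟩
    count (a ∷ A) 0 v                ≡⟨ count-∷ (∉-below a<A) 0 v ⟩
    count A 0 v + count [ a ] 0 v    ≤⟨ +-monoʳ-≤ (count A 0 v) (count-singleton≤1 a 0 v) ⟩
    count A 0 v + 1                  ≡⟨ +-comm _ 1 ⟩
    suc (count A 0 v)                ∎)
    where open ≤-Reasoning

data LargestBelow (s : ℕ) (R : List ℕ) : Maybe ℕ → Set where
  none : (∀ {v} → v ∈ R → s ≤ v) → LargestBelow s R nothing
  some : ∀ {r} → r ∈ R → r < s → (∀ {v} → v ∈ R → v < s → v ≤ r) → LargestBelow s R (just r)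

largestBelow-spec : ∀ s R → LargestBelow s R (largestBelow s R)
largestBelow-spec s [] = none λ ()
largestBelow-spec s (t ∷ R) with t <? s
... | no t≮s = extend (largestBelow-spec s R)
  where
  extend : ∀ {m} → LargestBelow s R m → LargestBelow s (t ∷ R) m
  extend (none s≤R) = none λ { (here refl) → ≮⇒≥ t≮s ; (there v∈R) → s≤R v∈R }
  extend (some r∈R r<s r-max) = some (there r∈R) r<s
    λ { (here refl) v<s → ⊥-elim (t≮s v<s) ; (there v∈R) v<s → r-max v∈R v<s }
... | yes t<s with largestBelow s R | largestBelow-spec s R
...   | nothing | none s≤R = some (here refl) t<s
          λ { (here refl) _ → ≤-refl ; (there v∈R) v<s → ⊥-elim (<⇒≱ v<s (s≤R v∈R)) }
...   | just u  | some u∈R u<s u-max = some t⊔u∈ (⊔-lub t<s u<s)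
          λ { (here refl) _ → m≤m⊔n t u ; (there v∈R) v<s → ≤-trans (u-max v∈R v<s) (m≤n⊔m t u) }
  where
  t⊔u∈ : t ⊔ u ∈ t ∷ R
  t⊔u∈ with ⊔-sel t u
  ... | inj₁ t⊔u≡t = here t⊔u≡t
  ... | inj₂ t⊔u≡u = there (subst (_∈ R) (sym t⊔u≡u) u∈R)

Matched : List ℕ → List ℕ → ℕ → Set
Matched R D t = ∃[ w ] t < w × count R (suc t) w < count D (suc t) (suc w)

Matched-monoᶜ : ∀ {R D D′ t} → (∀ w → t < w → count D (suc t) (suc w) ≤ count D′ (suc t) (suc w)) →
  Matched R D t → Matched R D′ t
Matched-monoᶜ D≤D′ (w , t<w , lt) = w , t<w , <-≤-trans lt (D≤D′ w t<w)

Matched-monoᴰ : ∀ {R D D′ t} → (∀ {v} → v ∈ D → v ∈ D′) → Matched R D t → Matched R D′ t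
Matched-monoᴰ {t = t} D⊆D′ = Matched-monoᶜ (λ w _ → count-⊆ (suc t) (suc w) D⊆D′)

Matched-antitoneᴿ : ∀ {R R′ D t} → (∀ w → t < w → count R (suc t) w ≤ count R′ (suc t) w) →
  Matched R′ D t → Matched R D t
Matched-antitoneᴿ R≤R′ (w , t<w , lt) = w , t<w , ≤-<-trans (R≤R′ w t<w) lt

Matched-reverse : ∀ {R D t} → Matched R (reverse D) t ⇔ Matched R D t
Matched-reverse = mk⇔ (Matched-monoᴰ Any.reverse⁻) (Matched-monoᴰ Any.reverse⁺)

¬Matched-above : ∀ {R D t} → (∀ {v} → v ∈ D → v ≤ t) → ¬ Matched R D t
¬Matched-above {t = t} D≤t (w , _ , lt) =
  <⇒≱ lt (≤-trans (≤-reflexive (count-zero (suc t) (suc w) (λ t<v _ v∈D → <⇒≱ t<v (D≤t v∈D)))) z≤n)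

¬Matched⇒bound : ∀ {R D t} → ¬ Matched R D t → ∀ w → t < w → count D (suc t) (suc w) ≤ count R (suc t) w
¬Matched⇒bound ¬m w t<w = ≮⇒≥ (λ lt → ¬m (w , t<w , lt))

Matched-cut : ∀ {R D v m} → v < m → m ∉ R → ¬ Matched R D m → Matched R D v →
  ∃[ w ] w ≤ m × v < w × count R (suc v) w < count D (suc v) (suc w)
Matched-cut {R} {D} {v} {m} v<m m∉R ¬m (w , v<w , lt) with w ≤? m
... | yes w≤m = w , w≤m , v<w , lt
... | no w≰m  = m , ≤-refl , v<m , +-cancelʳ-< (count R (suc m) w) _ _ (begin-strict
  count R (suc v) m + count R (suc m) w           ≡⟨ count-split-at-∉ m∉R v<m m<w ⟨
  count R (suc v) w                               <⟨ lt ⟩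
  count D (suc v) (suc w)                         ≡⟨ count-split D (s≤s (<⇒≤ v<m)) (s≤s (<⇒≤ m<w)) ⟩
  count D (suc v) (suc m) + count D (suc m) (suc w) ≤⟨ +-monoʳ-≤ _ (¬Matched⇒bound ¬m w m<w) ⟩
  count D (suc v) (suc m) + count R (suc m) w     ∎)
  where
  open ≤-Reasoning
  m<w : m < w
  m<w = ≰⇒> w≰m

module GreedyStep {R ds : List ℕ} {r s : ℕ} (r∈R : r ∈ R) (r<s : r < s)
            (r-max : ∀ {v} → v ∈ R → v < s → v ≤ r) (ds<s : All (_< s) ds) where

  private
    R′ : List ℕ
    R′ = removeS r R

    s∉ds : s ∉ ds
    s∉ds = ∉-above ds<s

    gap : ∀ p → r < p → count R p s ≡ 0
    gap p r<p = count-zero p s (λ p≤v v<s v∈R → <⇒≱ (<-≤-trans r<p p≤v) (r-max v∈R v<s))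

    s∷ds≤ : ∀ {t} → t ∈ R → r < t → ∀ {v} → v ∈ s ∷ ds → v ≤ t
    s∷ds≤ t∈R r<t (here refl)  = ≮⇒≥ (λ t<s → <⇒≱ r<t (r-max t∈R t<s))
    s∷ds≤ t∈R r<t (there v∈ds) = <⇒≤ (<-≤-trans (All.lookup ds<s v∈ds) (s∷ds≤ t∈R r<t (here refl)))

    matched-after : ∀ {t} → t < r → Matched R′ ds t → Matched R (s ∷ ds) t
    matched-after {t} t<r (w , t<w , lt) with w ≤? r | s ≤? w
    ... | yes w≤r | _ = w , t<w , (begin-strict
      count R (suc t) w              ≡⟨ count-removeS-outside r∈R (inj₂ w≤r) ⟩
      count R′ (suc t) w             <⟨ lt ⟩
      count ds (suc t) (suc w)       ≤⟨ count-⊆ (suc t) (suc w) there ⟩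
      count (s ∷ ds) (suc t) (suc w) ∎)
      where open ≤-Reasoning
    ... | no w≰r | yes s≤w = w , t<w , (begin-strict
      count R (suc t) w              ≡⟨ count-removeS-inside r∈R t<r (≰⇒> w≰r) ⟩
      suc (count R′ (suc t) w)       <⟨ s≤s lt ⟩
      suc (count ds (suc t) (suc w)) ≡⟨ count-∷-inside s∉ds (<-trans t<r r<s) (s≤s s≤w) ⟨
      count (s ∷ ds) (suc t) (suc w) ∎)
      where open ≤-Reasoning
    -- the window ends strictly between r and s: stretch it to s, as R has nothing in (r, s)
    ... | no w≰r | no s≰w = s , <-trans t<r r<s , (begin-strict
      count R (suc t) s              ≡⟨ count-split R (m≤n⇒m≤1+n t<r) r<s ⟩
      count R (suc t) (suc r) + count R (suc r) s   ≡⟨ cong (count R (suc t) (suc r) +_) (gap (suc r) ≤-refl) ⟩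
      count R (suc t) (suc r) + 0    ≡⟨ +-identityʳ _ ⟩
      count R (suc t) (suc r)        ≡⟨ count-removeS-inside r∈R t<r ≤-refl ⟩
      suc (count R′ (suc t) (suc r)) ≤⟨ s≤s (count-monoʳ R′ (suc t) (≰⇒> w≰r)) ⟩
      suc (count R′ (suc t) w)       <⟨ s≤s lt ⟩
      suc (count ds (suc t) (suc w)) ≤⟨ s≤s (count-monoʳ ds (suc t) (s≤s (<⇒≤ (≰⇒> s≰w)))) ⟩
      suc (count ds (suc t) (suc s)) ≡⟨ count-∷-inside s∉ds (<-trans t<r r<s) ≤-refl ⟨
      count (s ∷ ds) (suc t) (suc s) ∎)
      where open ≤-Reasoning

    matched-before : ∀ {t} → t < r → Matched R (s ∷ ds) t → Matched R′ ds t
    matched-before {t} t<r (w , t<w , lt) with s ≤? w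
    ... | yes s≤w = w , t<w , s≤s⁻¹ (begin-strict
      suc (count R′ (suc t) w)       ≡⟨ count-removeS-inside r∈R t<r (<-≤-trans r<s s≤w) ⟨
      count R (suc t) w              <⟨ lt ⟩
      count (s ∷ ds) (suc t) (suc w) ≡⟨ count-∷-inside s∉ds (<-trans t<r r<s) (s≤s s≤w) ⟩
      suc (count ds (suc t) (suc w)) ∎)
      where open ≤-Reasoning
    ... | no s≰w = w , t<w , (begin-strict
      count R′ (suc t) w             ≤⟨ count-⊆ (suc t) w (λ v∈ → proj₁ (∈-removeS⁻ r R v∈)) ⟩
      count R (suc t) w              <⟨ lt ⟩
      count (s ∷ ds) (suc t) (suc w) ≡⟨ count-∷-outside s∉ds (inj₂ (≰⇒> s≰w)) ⟩
      count ds (suc t) (suc w)       ∎)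
      where open ≤-Reasoning

  r-matched : Matched R (s ∷ ds) r
  r-matched = s , r<s , (begin-strict
    count R (suc r) s             ≡⟨ gap (suc r) ≤-refl ⟩
    0                             <⟨ z<s ⟩
    1                             ≤⟨ count-∈ (suc r) (suc s) (here refl) r<s ≤-refl ⟩
    count (s ∷ ds) (suc r) (suc s) ∎)
    where open ≤-Reasoning

  matched-step⁻ : ∀ {t} → t ∈ removeS r R → Matched (removeS r R) ds t → Matched R (s ∷ ds) t
  matched-step⁻ {t} t∈R′ m with ∈-removeS⁻ r R t∈R′ | <-cmp t r
  ... | _   , _   | tri< t<r _ _ = matched-after t<r m
  ... | _   , t≢r | tri≈ _ t≡r _ = ⊥-elim (t≢r t≡r)
  ... | t∈R , _   | tri> _ _ r<t = ⊥-elim (¬Matched-above (s∷ds≤ t∈R r<t ∘ there) m)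

  matched-step⁺ : ∀ {t} → t ∈ R → t ≢ r → Matched R (s ∷ ds) t → Matched (removeS r R) ds t
  matched-step⁺ {t} t∈R t≢r m with <-cmp t r
  ... | tri< t<r _ _ = matched-before t<r m
  ... | tri≈ _ t≡r _ = ⊥-elim (t≢r t≡r)
  ... | tri> _ _ r<t = ⊥-elim (¬Matched-above (s∷ds≤ t∈R r<t) m)

Matched-∷-≤ : ∀ {R s ds t} → s ∉ ds → s ≤ t → Matched R (s ∷ ds) t → Matched R ds t
Matched-∷-≤ s∉ds s≤t (w , t<w , lt) = w , t<w , subst (_ <_) (count-∷-outside s∉ds (inj₁ (s≤s s≤t))) lt

∈-picks⁻ : ∀ {t} R ds → AllPairs _>_ ds → t ∈ picks R ds → t ∈ R × Matched R ds t
∈-picks⁻ R (s ∷ ds) (ds<s ∷ dec) t∈ with largestBelow s R | largestBelow-spec s R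
... | nothing | none _ = map₂ (Matched-monoᴰ there) (∈-picks⁻ R ds dec t∈)
... | just r  | some r∈R r<s r-max with t∈
...   | here refl = r∈R , GreedyStep.r-matched r∈R r<s r-max ds<s
...   | there t∈′ with ∈-picks⁻ (removeS r R) ds dec t∈′
...     | t∈R′ , m = proj₁ (∈-removeS⁻ r R t∈R′) , GreedyStep.matched-step⁻ r∈R r<s r-max ds<s t∈R′ m

∈-picks⁺ : ∀ {t} R ds → AllPairs _>_ ds → t ∈ R → Matched R ds t → t ∈ picks R ds
∈-picks⁺ R []       _             _   m = ⊥-elim (¬Matched-above (λ ()) m)
∈-picks⁺ {t} R (s ∷ ds) (ds<s ∷ dec) t∈R m with largestBelow s R | largestBelow-spec s R
... | nothing | none s≤R = ∈-picks⁺ R ds dec t∈R (Matched-∷-≤ (∉-above ds<s) (s≤R t∈R) m)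
... | just r  | some r∈R r<s r-max with t ≟ r
...   | yes refl = here refl
...   | no t≢r   = there (∈-picks⁺ (removeS r R) ds dec (∈-removeS⁺ r R t∈R t≢r)
                            (GreedyStep.matched-step⁺ r∈R r<s r-max ds<s t∈R t≢r m))

∈-picks-reverse⇔ : ∀ {X D t} → Increasing D → t ∈ picks X (reverse D) ⇔ (t ∈ X × Matched X D t)
∈-picks-reverse⇔ {X} {D} inc = mk⇔
  (λ t∈ → map₂ (Equivalence.to Matched-reverse) (∈-picks⁻ X (reverse D) (Decreasing-reverse inc) t∈))
  (λ (t∈X , m) → ∈-picks⁺ X (reverse D) (Decreasing-reverse inc) t∈X (Equivalence.from Matched-reverse m))

∈-◁⇔ : ∀ {X D t} → Increasing D → t ∈ X ◁ D ⇔ (t ∈ X × Matched X D t)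
∈-◁⇔ {X} {D} inc = mk⇔
  (λ t∈ → Equivalence.to (∈-picks-reverse⇔ inc) (proj₂ (∈-filter⁻ picked? {xs = X} t∈)))
  (λ (t∈X , m) → ∈-filter⁺ picked? t∈X (Equivalence.from (∈-picks-reverse⇔ inc) (t∈X , m)))
  where
  picked? : ∀ v → Dec (v ∈ picks X (reverse D))
  picked? v = v ∈? picks X (reverse D)

◁-cong : ∀ {U A A′} → Increasing A → Increasing A′ →
  (∀ {u} → u ∈ U → Matched U A u ⇔ Matched U A′ u) → U ◁ A ≡ U ◁ A′
◁-cong {U} {A} {A′} incA incA′ equiv =
  filter-≐ (λ t → t ∈? picks U (reverse A)) (λ t → t ∈? picks U (reverse A′))
    (transfer incA incA′ (Equivalence.to ∘ equiv) , transfer incA′ incA (Equivalence.from ∘ equiv)) U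
  where
  transfer : ∀ {B B′} → Increasing B → Increasing B′ → (∀ {u} → u ∈ U → Matched U B u → Matched U B′ u) →
    ∀ {t} → t ∈ picks U (reverse B) → t ∈ picks U (reverse B′)
  transfer incB incB′ B⇒B′ t∈ with Equivalence.to (∈-picks-reverse⇔ incB) t∈
  ... | t∈U , m = Equivalence.from (∈-picks-reverse⇔ incB′) (t∈U , B⇒B′ t∈U m)

module MatchedExchange {U T A A′ : List ℕ} {x z : ℕ} (z≤x : z ≤ x)
  (U≼T : ∀ v → v < x → count U v x ≤ count T (suc v) x)
  (e : Exchange A A′ x z) (T⊆A : ∀ {t} → z < t → t < x → t ∈ T → t ∈ A) where

  open ExchangeCounts e
  open ExchangeCounts (exchange-sym e) using () renaming (exchange-≤ to exchange-≥)

  private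
    T≤A : ∀ p → z < p → count T p x ≤ count A p x
    T≤A p z<p = count-mono p x (λ p≤v v<x → T⊆A (<-≤-trans z<p p≤v) v<x)

    matched⇔-above : ∀ {u} → x ≤ u → Matched U A u ⇔ Matched U A′ u
    matched⇔-above {u} x≤u = mk⇔ (Matched-monoᶜ λ w _ → ≤-reflexive (A≡A′ w))
                                 (Matched-monoᶜ λ w _ → ≤-reflexive (sym (A≡A′ w)))
      where
      A≡A′ : ∀ w → count A (suc u) (suc w) ≡ count A′ (suc u) (suc w)
      A≡A′ w = exchange-outside (inj₁ (s≤s x≤u)) (inj₁ (s≤s (≤-trans z≤x x≤u)))

    matched⇔-below : ∀ {u} → u < z → Matched U A u ⇔ Matched U A′ u
    matched⇔-below {u} u<z = mk⇔ to from
      where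
      A≡A′ : ∀ {w} → x ≤ w → count A (suc u) (suc w) ≡ count A′ (suc u) (suc w)
      A≡A′ x≤w = exchange-inside (≤-trans u<z z≤x) (s≤s x≤w) u<z (s≤s (≤-trans z≤x x≤w))
      to : Matched U A u → Matched U A′ u
      to (w , u<w , lt) with w <? z | x ≤? w
      ... | yes w<z | _ = w , u<w ,
        subst (count U (suc u) w <_) (exchange-outside (inj₂ (≤-trans w<z z≤x)) (inj₂ w<z)) lt
      ... | no _ | yes x≤w = w , u<w ,
        subst (count U (suc u) w <_) (A≡A′ x≤w) lt
      ... | no w≮z | no x≰w = x , <-≤-trans u<z z≤x , (begin-strict
        count U (suc u) x                          ≡⟨ count-split U u<w (<⇒≤ w<x) ⟩
        count U (suc u) w + count U w x
          ≤⟨ +-monoʳ-≤ (count U (suc u) w) (≤-trans (U≼T w w<x) (T≤A (suc w) (s≤s (≮⇒≥ w≮z)))) ⟩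
        count U (suc u) w + count A (suc w) x      <⟨ +-monoˡ-< (count A (suc w) x) lt ⟩
        count A (suc u) (suc w) + count A (suc w) x ≡⟨ count-split A (s≤s (<⇒≤ u<w)) w<x ⟨
        count A (suc u) x                          ≤⟨ count-monoʳ A (suc u) (n≤1+n x) ⟩
        count A (suc u) (suc x)                    ≡⟨ A≡A′ ≤-refl ⟩
        count A′ (suc u) (suc x)                   ∎)
        where
        open ≤-Reasoning
        w<x : w < x
        w<x = ≰⇒> x≰w
      from : Matched U A′ u → Matched U A u
      from = Matched-monoᶜ λ w u<w → case x ≤? w of λ where
        (yes x≤w) → ≤-reflexive (sym (A≡A′ x≤w))
        (no x≰w)  → exchange-≥ (inj₂ (≰⇒> x≰w))

    matched⇔-between : ∀ {u} → z ≤ u → u < x → u ∈ U → Matched U A u ⇔ Matched U A′ u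
    matched⇔-between {u} z≤u u<x u∈U = mk⇔ (λ _ → A′-matched) (λ _ → A-matched)
      where
      U<A : count U (suc u) x < count A (suc u) (suc x)
      U<A = begin-strict
        count U (suc u) x                    <⟨ n<1+n _ ⟩
        suc (count U (suc u) x)              ≡⟨ count-∈-head u∈U u<x ⟨
        count U u x                          ≤⟨ U≼T u u<x ⟩
        count T (suc u) x                    ≤⟨ T≤A (suc u) (s≤s z≤u) ⟩
        count A (suc u) x                    ≤⟨ count-monoʳ A (suc u) (n≤1+n x) ⟩
        count A (suc u) (suc x)              ∎
        where open ≤-Reasoning
      A-matched : Matched U A u
      A-matched = x , u<x , U<A
      A′-matched : Matched U A′ u
      A′-matched = x , u<x , ≤-trans U<A (exchange-≤ (inj₁ (s≤s z≤u)))

  matched-exchange : ∀ {u} → u ∈ U → Matched U A u ⇔ Matched U A′ u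
  matched-exchange {u} u∈U with x ≤? u | u <? z
  ... | yes x≤u | _       = matched⇔-above x≤u
  ... | no _    | yes u<z = matched⇔-below u<z
  ... | no x≰u  | no u≮z  = matched⇔-between (≮⇒≥ u≮z) (≰⇒> x≰u) u∈U

⪯ᶜ-window : ∀ {A B x} → A ⪯ᶜ B → count A 0 x ≡ count B 0 x → ∀ v → v < x → count A v x ≤ count B (suc v) x
⪯ᶜ-window {A} {B} {x} A⪯ᶜB A≡B v v<x = +-cancelˡ-≤ (count A 0 v) _ _ (begin
  count A 0 v + count A v x                  ≡⟨ count-split A z≤n (<⇒≤ v<x) ⟨
  count A 0 x                                ≡⟨ A≡B ⟩
  count B 0 x                                ≡⟨ count-split B z≤n v<x ⟩
  count B 0 (suc v) + count B (suc v) x      ≤⟨ +-monoˡ-≤ (count B (suc v) x) (A⪯ᶜB v) ⟩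
  count A 0 v + count B (suc v) x            ∎)
  where open ≤-Reasoning

last-witness : ∀ {P : ℕ → Set} → (∀ n → Dec (P n)) → ∀ {a b} → a < b → P a →
  ∃[ v ] a ≤ v × v < b × P v × (∀ {u} → v < u → u < b → ¬ P u)
last-witness {P} P? {a} {suc b} a<1+b Pa with P? b
... | yes Pb = b , s≤s⁻¹ a<1+b , ≤-refl , Pb , λ b<u u<1+b → ⊥-elim (<⇒≱ b<u (s≤s⁻¹ u<1+b))
... | no ¬Pb with a <? b
...   | no a≮b  = ⊥-elim (¬Pb (subst P (≤-antisym (s≤s⁻¹ a<1+b) (≮⇒≥ a≮b)) Pa))
...   | yes a<b with last-witness P? a<b Pa
...     | v , a≤v , v<b , Pv , v-last = v , a≤v , m<n⇒m<1+n v<b , Pv , v-last′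
  where
  v-last′ : ∀ {u} → v < u → u < suc b → ¬ P u
  v-last′ {u} v<u u<1+b with u ≟ b
  ... | yes refl = ¬Pb
  ... | no u≢b   = v-last v<u (≤∧≢⇒< (s≤s⁻¹ u<1+b) u≢b)

module MinimalSwap {U T S : List ℕ} (incU : Increasing U) (incT : Increasing T) (incS : Increasing S)
  (U⪯T : U ⪯ T) (T⪯S : T ⪯ S) {x : ℕ} (x∉T : x ∉ T) (U≡T-below-x : count U 0 x ≡ count T 0 x)
  {y : ℕ} (y∈T : y ∈ T) (y<x : y < x) (T′⪯S : removeS y (insertS x T) ⪯ S)
  (y-min : ∀ z → z ∈ T → z < x → removeS z (insertS x T) ⪯ S → y ≤ z) where

  T′ : List ℕ
  T′ = removeS y (insertS x T)

  incT′ : Increasing T′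
  incT′ = Increasing-removeS y (Increasing-insertS x incT)

  T⇄T′ : Exchange T T′ x y
  T⇄T′ = exchange-insertS-removeS x∉T y∈T

  x∈T′ : x ∈ T′
  x∈T′ = x∈insertS-removeS {T = T} (λ x≡y → <⇒≢ y<x (sym x≡y))

  open ExchangeCounts T⇄T′

  U≼T : ∀ v → v < x → count U v x ≤ count T (suc v) x
  U≼T = ⪯ᶜ-window (⪯⇒⪯ᶜ incU incT U⪯T) U≡T-below-x

  ◁T≡◁T′ : U ◁ T ≡ U ◁ T′
  ◁T≡◁T′ = ◁-cong incT incT′ (MatchedExchange.matched-exchange (<⇒≤ y<x) U≼T T⇄T′ (λ _ _ t∈T → t∈T))

  private
    exchange-below-y-⪯ : ∀ {z} → z ∈ T → z < y → (∀ {v} → v ∈ T → v < y → v ≤ z) →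
      count S 0 (suc y) < count T 0 y → removeS z (insertS x T) ⪯ S
    exchange-below-y-⪯ {z} z∈T z<y z-max S<T =
      ⪯ᶜ⇒⪯ (Increasing-removeS z (Increasing-insertS x incT)) incS T″⪯ᶜS
      where
      T″ : List ℕ
      T″ = removeS z (insertS x T)
      T⇄T″ : Exchange T T″ x z
      T⇄T″ = exchange-insertS-removeS x∉T z∈T
      module T⇄T″ = ExchangeCounts T⇄T″
      module T″⇄T = ExchangeCounts (exchange-sym T⇄T″)
      module T′⇄T″ = ExchangeCounts (exchange-trans T⇄T′ T⇄T″)
      no-T-between : ∀ {v} → z < v → count T v y ≡ 0
      no-T-between z<v = count-zero _ y λ v≤u u<y u∈T → <⇒≱ (<-≤-trans z<v v≤u) (z-max u∈T u<y)
      T″⪯ᶜS : T″ ⪯ᶜ S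
      T″⪯ᶜS v with v ≤? z | v ≤? y
      ... | yes v≤z | _ = begin
        count S 0 (suc v)       ≤⟨ ⪯⇒⪯ᶜ incT incS T⪯S v ⟩
        count T 0 v             ≡⟨ T⇄T″.exchange-outside (inj₂ (≤-trans v≤z (<⇒≤ (<-trans z<y y<x)))) (inj₂ v≤z) ⟩
        count T″ 0 v            ∎
        where open ≤-Reasoning
      ... | no v≰z | yes v≤y = s≤s⁻¹ (begin
        suc (count S 0 (suc v)) ≤⟨ s≤s (count-monoʳ S 0 (s≤s v≤y)) ⟩
        suc (count S 0 (suc y)) ≤⟨ S<T ⟩
        count T 0 y             ≡⟨ count-split T z≤n v≤y ⟩
        count T 0 v + count T v y ≡⟨ cong (count T 0 v +_) (no-T-between (≰⇒> v≰z)) ⟩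
        count T 0 v + 0         ≡⟨ +-identityʳ _ ⟩
        count T 0 v             ≡⟨ T″⇄T.exchange-gain z≤n (≰⇒> v≰z) (inj₂ (≤-trans v≤y (<⇒≤ y<x))) ⟩
        suc (count T″ 0 v)      ∎)
        where open ≤-Reasoning
      ... | no v≰z | no v≰y = begin
        count S 0 (suc v)       ≤⟨ ⪯⇒⪯ᶜ incT′ incS T′⪯S v ⟩
        count T′ 0 v            ≡⟨ T′⇄T″.exchange-inside z≤n (≰⇒> v≰y) z≤n (≰⇒> v≰z) ⟩
        count T″ 0 v            ∎
        where open ≤-Reasoning

  y-tight : count T 0 y ≤ count S 0 (suc y)
  y-tight with count T 0 y ≤? count S 0 (suc y)
  ... | yes T≤S = T≤S
  ... | no T≰S with largestBelow y T | largestBelow-spec y T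
  ...   | nothing | none y≤T = ⊥-elim (T≰S (≤-trans (≤-reflexive (count-≥ 0 y y≤T)) z≤n))
  ...   | just z  | some z∈T z<y z-max =
    ⊥-elim (<⇒≱ z<y (y-min z z∈T (<-trans z<y y<x) (exchange-below-y-⪯ z∈T z<y z-max (≰⇒> T≰S))))

  T′≡T-below-y : count T′ 0 (suc y) ≡ count T 0 y
  T′≡T-below-y = suc-injective (begin
    suc (count T′ 0 (suc y))    ≡⟨ ExchangeCounts.exchange-gain (exchange-sym T⇄T′) z≤n ≤-refl (inj₂ y<x) ⟨
    count T 0 (suc y)           ≡⟨ count-∈-last y∈T z≤n ⟩
    suc (count T 0 y)           ∎)
    where open ≡-Reasoning

  ¬Matched-y : ¬ Matched T′ S y
  ¬Matched-y (w , y<w , T′<S) = <⇒≱ (begin-strict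
    count T′ 0 w                                    ≡⟨ count-split T′ z≤n y<w ⟩
    count T′ 0 (suc y) + count T′ (suc y) w         ≡⟨ cong (_+ count T′ (suc y) w) T′≡T-below-y ⟩
    count T 0 y + count T′ (suc y) w                <⟨ +-mono-≤-< y-tight T′<S ⟩
    count S 0 (suc y) + count S (suc y) (suc w)     ≡⟨ count-split S z≤n (s≤s (<⇒≤ y<w)) ⟨
    count S 0 (suc w)                               ∎) (⪯⇒⪯ᶜ incT′ incS T′⪯S w)
    where open ≤-Reasoning

  module OnSubset {S′ : List ℕ} (incS′ : Increasing S′) (S′⊆S : ∀ {s} → s ∈ S′ → s ∈ S) where

    A A′ : List ℕ
    A  = T ◁ S′
    A′ = T′ ◁ S′

    incA : Increasing A
    incA = Increasing-◁ S′ incT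

    incA′ : Increasing A′
    incA′ = Increasing-◁ S′ incT′

    ∈A⇔ : ∀ {t} → t ∈ A ⇔ (t ∈ T × Matched T S′ t)
    ∈A⇔ = ∈-◁⇔ incS′

    ∈A′⇔ : ∀ {t} → t ∈ A′ ⇔ (t ∈ T′ × Matched T′ S′ t)
    ∈A′⇔ = ∈-◁⇔ incS′

    ¬Matched-y′ : ¬ Matched T′ S′ y
    ¬Matched-y′ = ¬Matched-y ∘ Matched-monoᴰ S′⊆S

    y∉A′ : y ∉ A′
    y∉A′ y∈A′ = ¬Matched-y′ (proj₂ (Equivalence.to ∈A′⇔ y∈A′))

    x∉A : x ∉ A
    x∉A x∈A = x∉T (proj₁ (Equivalence.to ∈A⇔ x∈A))

    matched⇔-above-x : ∀ {t} → x ≤ t → Matched T S′ t ⇔ Matched T′ S′ t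
    matched⇔-above-x {t} x≤t = mk⇔
      (Matched-antitoneᴿ λ w _ → ≤-reflexive (sym (T≡T′ w)))
      (Matched-antitoneᴿ λ w _ → ≤-reflexive (T≡T′ w))
      where
      T≡T′ : ∀ w → count T (suc t) w ≡ count T′ (suc t) w
      T≡T′ w = exchange-outside (inj₁ (s≤s x≤t)) (inj₁ (s≤s (≤-trans (<⇒≤ y<x) x≤t)))

    matched-T′⇒T : ∀ {t} → y ≤ t → Matched T′ S′ t → Matched T S′ t
    matched-T′⇒T y≤t = Matched-antitoneᴿ λ w _ → exchange-≤ (inj₁ (s≤s y≤t))

    matched⇔-below-y : ∀ {t} → t < y → Matched T S′ t ⇔ Matched T′ S′ t
    matched⇔-below-y {t} t<y = mk⇔ to from
      where
      T≡T′ : ∀ {w} → w ≤ y → count T (suc t) w ≡ count T′ (suc t) w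
      T≡T′ w≤y = exchange-outside (inj₂ (≤-trans w≤y (<⇒≤ y<x))) (inj₂ w≤y)
      S′≤T′ : ∀ {w} → y < w → count S′ (suc y) (suc w) ≤ count T′ (suc y) w
      S′≤T′ = ¬Matched⇒bound ¬Matched-y′ _
      S′-split : ∀ {w} → y < w →
        count S′ (suc t) (suc w) ≡ count S′ (suc t) (suc y) + count S′ (suc y) (suc w)
      S′-split y<w = count-split S′ (s≤s (<⇒≤ t<y)) (s≤s (<⇒≤ y<w))
      to : Matched T S′ t → Matched T′ S′ t
      to (w , t<w , lt) with w ≤? y
      ... | yes w≤y = w , t<w , subst (_< count S′ (suc t) (suc w)) (T≡T′ w≤y) lt
      ... | no w≰y  = y , t<y , subst (_< count S′ (suc t) (suc y)) (T≡T′ ≤-refl)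
        (+-cancelʳ-< (count T′ (suc y) w) _ _ (begin-strict
          count T (suc t) y + count T′ (suc y) w          ≤⟨ +-monoʳ-≤ _ (exchange-≤suc (suc y) w) ⟩
          count T (suc t) y + suc (count T (suc y) w)     ≡⟨ count-split-at-∈ y∈T t<y y<w ⟨
          count T (suc t) w                               <⟨ lt ⟩
          count S′ (suc t) (suc w)                        ≡⟨ S′-split y<w ⟩
          count S′ (suc t) (suc y) + count S′ (suc y) (suc w) ≤⟨ +-monoʳ-≤ _ (S′≤T′ y<w) ⟩
          count S′ (suc t) (suc y) + count T′ (suc y) w   ∎))
        where
        open ≤-Reasoning
        y<w : y < w
        y<w = ≰⇒> w≰y
      from : Matched T′ S′ t → Matched T S′ t
      from (w , t<w , lt) with w ≤? y
      ... | yes w≤y = w , t<w , subst (_< count S′ (suc t) (suc w)) (sym (T≡T′ w≤y)) lt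
      ... | no w≰y  = y , t<y , +-cancelʳ-< (count T′ (suc y) w) _ _ (begin-strict
          count T (suc t) y + count T′ (suc y) w          ≡⟨ cong (_+ count T′ (suc y) w) (T≡T′ ≤-refl) ⟩
          count T′ (suc t) y + count T′ (suc y) w
            ≡⟨ cong (_+ count T′ (suc y) w) (count-∉-last (y∉removeS y (insertS x T)) t<y) ⟨
          count T′ (suc t) (suc y) + count T′ (suc y) w   ≡⟨ count-split T′ (s≤s (<⇒≤ t<y)) y<w ⟨
          count T′ (suc t) w                              <⟨ lt ⟩
          count S′ (suc t) (suc w)                        ≡⟨ S′-split y<w ⟩
          count S′ (suc t) (suc y) + count S′ (suc y) (suc w) ≤⟨ +-monoʳ-≤ _ (S′≤T′ y<w) ⟩
          count S′ (suc t) (suc y) + count T′ (suc y) w   ∎)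
        where
        open ≤-Reasoning
        y<w : y < w
        y<w = ≰⇒> w≰y

    A′⊆A : ∀ {v} → v ≢ x → v ∈ A′ → v ∈ A
    A′⊆A {v} v≢x v∈A′ with Equivalence.to ∈A′⇔ v∈A′
    ... | v∈T′ , m = Equivalence.from ∈A⇔ (∈-insertS-removeS⁻ v≢x v∈T′ , m′)
      where
      m′ : Matched T S′ v
      m′ with v <? y
      ... | yes v<y = Equivalence.from (matched⇔-below-y v<y) m
      ... | no v≮y  = matched-T′⇒T (≮⇒≥ v≮y) m

    A⊆A′-via : ∀ {v} → v ∈ A → (Matched T S′ v → Matched T′ S′ v) → v ∈ A′
    A⊆A′-via {v} v∈A T⇒T′ with Equivalence.to ∈A⇔ v∈A
    ... | v∈T , m = Equivalence.from ∈A′⇔ (∈-insertS-removeS⁺ v≢y v∈T , T⇒T′ m)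
      where
      v≢y : v ≢ y
      v≢y refl = ¬Matched-y′ (T⇒T′ m)

    A⊆A′-below-y : ∀ {v} → v < y → v ∈ A → v ∈ A′
    A⊆A′-below-y v<y v∈A = A⊆A′-via v∈A (Equivalence.to (matched⇔-below-y v<y))

    A⊆A′-above-x : ∀ {v} → x < v → v ∈ A → v ∈ A′
    A⊆A′-above-x x<v v∈A = A⊆A′-via v∈A (Equivalence.to (matched⇔-above-x (<⇒≤ x<v)))

    ¬Matched-T′ : ∀ {t} → t ∈ T → t ∉ A′ → ¬ Matched T′ S′ t
    ¬Matched-T′ {t} t∈T t∉A′ m with t ≟ y
    ... | yes refl = ¬Matched-y′ m
    ... | no t≢y   = t∉A′ (Equivalence.from ∈A′⇔ (∈-insertS-removeS⁺ t≢y t∈T , m))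

    A⊆A′-if-x∉A′ : x ∉ A′ → ∀ {v} → v ∈ A → v ∈ A′
    A⊆A′-if-x∉A′ x∉A′ {v} v∈A with v <? y | x <? v
    ... | yes v<y | _       = A⊆A′-below-y v<y v∈A
    ... | no _    | yes x<v = A⊆A′-above-x x<v v∈A
    ... | no v≮y  | no x≮v  = A⊆A′-via v∈A T⇒T′
      where
      v<x : v < x
      v<x = ≤∧≢⇒< (≮⇒≥ x≮v) λ { refl → x∉A v∈A }
      ¬Matched-x : ¬ Matched T S′ x
      ¬Matched-x m = x∉A′ (Equivalence.from ∈A′⇔
        (x∈T′ , Equivalence.to (matched⇔-above-x ≤-refl) m))
      T⇒T′ : Matched T S′ v → Matched T′ S′ v
      T⇒T′ m with Matched-cut v<x x∉T ¬Matched-x m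
      ... | w , w≤x , v<w , lt =
        w , v<w ,
        subst (_< count S′ (suc v) (suc w)) (exchange-outside (inj₂ w≤x) (inj₁ (s≤s (≮⇒≥ v≮y)))) lt

    module XPicked (x∈A′ : x ∈ A′) {z : ℕ} (y≤z : y ≤ z) (z<x : z < x) (z∈T : z ∈ T) (z∉A′ : z ∉ A′)
                    (z-last : ∀ {u} → z < u → u < x → ¬ (u ∈ T × u ∉ A′)) where

      T⊆A′-above-z : ∀ {u} → z < u → u < x → u ∈ T → u ∈ A′
      T⊆A′-above-z {u} z<u u<x u∈T with u ∈? A′
      ... | yes u∈A′ = u∈A′
      ... | no u∉A′  = ⊥-elim (z-last z<u u<x (u∈T , u∉A′))

      T⊆A-above-z : ∀ {u} → z < u → u < x → u ∈ T → u ∈ A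
      T⊆A-above-z z<u u<x u∈T = A′⊆A (<⇒≢ u<x) (T⊆A′-above-z z<u u<x u∈T)

      Balanced : ℕ → Set
      Balanced v = count T (suc z) v ≤ count S′ (suc z) (suc v)

      private
        y-before : ∀ {v q} → z < v → y < suc v ⊎ q ≤ y
        y-before z<v = inj₁ (s≤s (≤-trans y≤z (<⇒≤ z<v)))

        S′-split : ∀ {v w} → z < v → v < w →
          count S′ (suc z) (suc w) ≡ count S′ (suc z) (suc v) + count S′ (suc v) (suc w)
        S′-split z<v v<w = count-split S′ (s≤s (<⇒≤ z<v)) (s≤s (<⇒≤ v<w))

        matched-from-x : Balanced x → Matched T S′ z
        matched-from-x bal
          with Equivalence.from (matched⇔-above-x ≤-refl) (proj₂ (Equivalence.to ∈A′⇔ x∈A′))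
        ... | w , x<w , lt = w , <-trans z<x x<w , (begin-strict
          count T (suc z) w                               ≡⟨ count-split-at-∉ x∉T z<x x<w ⟩
          count T (suc z) x + count T (suc x) w           <⟨ +-mono-≤-< bal lt ⟩
          count S′ (suc z) (suc x) + count S′ (suc x) (suc w) ≡⟨ S′-split z<x x<w ⟨
          count S′ (suc z) (suc w)                        ∎)
          where open ≤-Reasoning

      -- Walk right along windows (z, v] that S′ balances: an element v ∈ T ∩ (z, x) is picked
      -- from T′, and its window either extends the balanced one or makes z matched outright.
      climb : ∀ {v} → Acc _<_ (x ∸ v) → z < v → v ≤ x → Balanced v → Matched T S′ z
      climb {v} (acc rs) z<v v≤x bal with v <? x | v ∈? T
      ... | no v≮x  | _ = matched-from-x (subst Balanced (≤-antisym v≤x (≮⇒≥ v≮x)) bal)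
      ... | yes v<x | no v∉T = climb (rs (∸-monoʳ-< (n<1+n v) v<x)) (m<n⇒m<1+n z<v) v<x
        (≤-trans (≤-reflexive (count-∉-last v∉T z<v)) (≤-trans bal (count-monoʳ S′ (suc z) (n≤1+n (suc v)))))
      ... | yes v<x | yes v∈T with proj₂ (Equivalence.to ∈A′⇔ (T⊆A′-above-z z<v v<x v∈T))
      ...   | w , v<w , lt with w ≤? x
      ...     | yes w≤x = climb (rs (∸-monoʳ-< v<w w≤x)) (<-trans z<v v<w) w≤x (begin
        count T (suc z) w                               ≡⟨ count-split-at-∈ v∈T z<v v<w ⟩
        count T (suc z) v + suc (count T (suc v) w)
          ≡⟨ cong (λ c → count T (suc z) v + suc c) (exchange-outside (inj₂ w≤x) (y-before z<v)) ⟩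
        count T (suc z) v + suc (count T′ (suc v) w)    ≤⟨ +-mono-≤ bal lt ⟩
        count S′ (suc z) (suc v) + count S′ (suc v) (suc w) ≡⟨ S′-split z<v v<w ⟨
        count S′ (suc z) (suc w)                        ∎)
        where open ≤-Reasoning
      ...     | no w≰x  = w , <-trans z<v v<w , (begin-strict
        count T (suc z) w                               ≡⟨ count-split-at-∈ v∈T z<v v<w ⟩
        count T (suc z) v + suc (count T (suc v) w)
          ≡⟨ cong (count T (suc z) v +_) (exchange-gain v<x (≰⇒> w≰x) (y-before z<v)) ⟨
        count T (suc z) v + count T′ (suc v) w          <⟨ +-mono-≤-< bal lt ⟩
        count S′ (suc z) (suc v) + count S′ (suc v) (suc w) ≡⟨ S′-split z<v v<w ⟨
        count S′ (suc z) (suc w)                        ∎)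
        where open ≤-Reasoning

      z∈A : z ∈ A
      z∈A = Equivalence.from ∈A⇔ (z∈T , climb (<-wellFounded _) (n<1+n z) z<x
        (≤-trans (≤-reflexive (count-empty T ≤-refl)) z≤n))

      matched-T⇒T′-below-z : ∀ {v} → y ≤ v → v < z → Matched T S′ v → Matched T′ S′ v
      matched-T⇒T′-below-z {v} y≤v v<z (w , v<w , lt) with w ≤? x
      ... | yes w≤x = w , v<w ,
        subst (_< count S′ (suc v) (suc w)) (exchange-outside (inj₂ w≤x) (inj₁ (s≤s y≤v))) lt
      ... | no w≰x  = z , v<z , +-cancelʳ-< (count T′ (suc z) w) _ _ (begin-strict
        count T′ (suc v) z + count T′ (suc z) w
          ≡⟨ cong₂ _+_ (exchange-outside (inj₂ (<⇒≤ z<x)) (inj₁ (s≤s y≤v)))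
                       (sym (exchange-gain z<x x<w (inj₁ (s≤s y≤z)))) ⟨
        count T (suc v) z + suc (count T (suc z) w)     ≡⟨ count-split-at-∈ z∈T v<z z<w ⟨
        count T (suc v) w                               <⟨ lt ⟩
        count S′ (suc v) (suc w)                        ≡⟨ count-split S′ (s≤s (<⇒≤ v<z)) (s≤s (<⇒≤ z<w)) ⟩
        count S′ (suc v) (suc z) + count S′ (suc z) (suc w)
          ≤⟨ +-monoʳ-≤ _ (¬Matched⇒bound (¬Matched-T′ z∈T z∉A′) w z<w) ⟩
        count S′ (suc v) (suc z) + count T′ (suc z) w   ∎)
        where
        open ≤-Reasoning
        x<w : x < w
        x<w = ≰⇒> w≰x
        z<w : z < w
        z<w = <-trans z<x x<w

      A⊆A′-off-z : ∀ {v} → v ≢ z → v ∈ A → v ∈ A′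
      A⊆A′-off-z {v} v≢z v∈A with v <? y | x <? v | v <? z
      ... | yes v<y | _       | _       = A⊆A′-below-y v<y v∈A
      ... | no _    | yes x<v | _       = A⊆A′-above-x x<v v∈A
      ... | no v≮y  | no _    | yes v<z = A⊆A′-via v∈A (matched-T⇒T′-below-z (≮⇒≥ v≮y) v<z)
      ... | no _    | no x≮v  | no v≮z  =
        T⊆A′-above-z (≤∧≢⇒< (≮⇒≥ v≮z) (v≢z ∘ sym)) (≤∧≢⇒< (≮⇒≥ x≮v) λ { refl → x∉A v∈A })
                     (proj₁ (Equivalence.to ∈A⇔ v∈A))

      A⇄A′ : Exchange A A′ x z
      A⇄A′ = exchange-swap x∉A x∈A′ z∈A z∉A′ A⊆A′-off-z A′⊆A

    exchange-◁ : ∃[ z ] z ≤ x × Exchange A A′ x z × (∀ {t} → z < t → t < x → t ∈ T → t ∈ A)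
    exchange-◁ with x ∈? A′
    ... | no x∉A′ = x , ≤-refl ,
      exchange-same (A⊆A′-if-x∉A′ x∉A′) (λ v∈A′ → A′⊆A (λ { refl → x∉A′ v∈A′ }) v∈A′) ,
      λ x<t t<x _ → ⊥-elim (<-asym x<t t<x)
    ... | yes x∈A′ with last-witness (λ t → (t ∈? T) ×-dec ¬? (t ∈? A′)) y<x (y∈T , y∉A′)
    ...   | z , y≤z , z<x , (z∈T , z∉A′) , z-last = z , <⇒≤ z<x , A⇄A′ , T⊆A-above-z
      where open XPicked x∈A′ y≤z z<x z∈T z∉A′ z-last

    ◁A≡◁A′ : U ◁ A ≡ U ◁ A′
    ◁A≡◁A′ with exchange-◁
    ... | z , z≤x , A⇄A′ , T⊆A = ◁-cong incA incA′ matched-exchange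
      where open MatchedExchange z≤x U≼T A⇄A′ T⊆A

lemma4p16 : (U T S : List ℕ) → IsPosSet U → IsPosSet T → IsPosSet S →
    U ⪯ T → T ⪯ S →
    (x : ℕ) → 0 < x → x ∉ T →
    length (below x U) ≡ length (below x T) →
    (y : ℕ) → y ∈ T → y < x → removeS y (insertS x T) ⪯ S →
    ((z : ℕ) → z ∈ T → z < x → removeS z (insertS x T) ⪯ S → y ≤ z) →
    ((S′ : List ℕ) → IsPosSet S′ → ((s : ℕ) → s ∈ S′ → s ∈ S) →
      U ◁ (T ◁ S′) ≡ U ◁ (removeS y (insertS x T) ◁ S′))
    × (U ◁ T ≡ U ◁ removeS y (insertS x T))
lemma4p16 U T S posU posT posS U⪯T T⪯S x _ x∉T |U<x|≡|T<x| y y∈T y<x T′⪯S y-min =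
  (λ S′ posS′ S′⊆S → OnSubset.◁A≡◁A′ (IsPosSet⇒Increasing posS′) (S′⊆S _)) , ◁T≡◁T′
  where
  incU : Increasing U
  incU = IsPosSet⇒Increasing posU
  incT : Increasing T
  incT = IsPosSet⇒Increasing posT
  open MinimalSwap incU incT (IsPosSet⇒Increasing posS) U⪯T T⪯S x∉T
    (trans (sym (length-below x incU)) (trans |U<x|≡|T<x| (length-below x incT))) y∈T y<x T′⪯S y-min
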